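{- Let $G$ be a finite group acting on a finite set $X$ and let $G'\le G$ be a subgroup acting transitively on $X$. Fix $x\in X$ and define $S:=\operatorname{Stab}_G(x)$, $N:=N_G(S)$, $A:=N/S$, and similarly $S':=\operatorname{Stab}_{G'}(x)$, $N':=N_{G'}(S')$, $A':=N'/S'$. Then $A$ is naturally isomorphic to a subgroup of $A'$.
   Context: All groups considered are finite permutation groups. -}

module Defs where

open import Data.Nat using (ℕ)
open import Data.Fin using (Fin)
open import Data.Fin.Permutation using (Permutation′; _⟨$⟩ʳ_; _≈_; id; flip; _∘ₚ_)
open import Data.Product using (_×_; Σ; ∃-syntax)
open import Relation.Binary.PropositionalEquality using (_≡_)

-- Finite permutation groups on X = Fin n.  Group elements are permutations
-- of Fin n; a (sub)group is given as a predicate on permutations.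

Perm : ℕ → Set
Perm n = Permutation′ n

module _ {n : ℕ} where

  _·ₓ_ : Perm n → Fin n → Fin n
  g ·ₓ x = g ⟨$⟩ʳ x

  -- group product with the usual (left action) convention: (g · h) x = g (h x)
  _·_ : Perm n → Perm n → Perm n
  g · h = h ∘ₚ g

  _⁻¹ : Perm n → Perm n
  g ⁻¹ = flip g

  PermSet : Set₁
  PermSet = Perm n → Set

  _⊆_ : PermSet → PermSet → Set
  H ⊆ K = ∀ g → H g → K g

  record IsPermGroup (H : PermSet) : Set where
    field
      resp : ∀ {g h} → g ≈ h → H g → H h
      id∈  : H id
      ·∈   : ∀ {g h} → H g → H h → H (g · h)
      ⁻¹∈  : ∀ {g} → H g → H (g ⁻¹)

  Transitive : PermSet → Set
  Transitive H = ∀ (y z : Fin n) → ∃[ g ] (H g × g ·ₓ y ≡ z)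

  Stab : PermSet → Fin n → PermSet
  Stab H x g = H g × g ·ₓ x ≡ x

  Normaliser : PermSet → PermSet → PermSet
  Normaliser H K g =
    H g × ((∀ k → K k → K ((g · k) · (g ⁻¹))) × (∀ k → K k → K (((g ⁻¹) · k) · g)))

  -- left-coset equality modulo K:  a K = b K  ⇔  a⁻¹ b ∈ K
  CosetEq : PermSet → Perm n → Perm n → Set
  CosetEq K a b = K ((a ⁻¹) · b)

  -- An injective group homomorphism N/S → N'/S' (quotients unfolded as
  -- representatives modulo coset equality), which is moreover the natural
  -- one: the image of the class of a is represented by an element acting
  -- on the base point x the same way as a.
  record NaturalEmbedding (x : Fin n) (N S N′ S′ : PermSet) : Set where
    field
      f         : (a : Perm n) → N a → Perm n
      f∈        : ∀ a (p : N a) → N′ (f a p)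
      wellDef   : ∀ a b (p : N a) (q : N b) → CosetEq S a b → CosetEq S′ (f a p) (f b q)
      hom       : ∀ a b (p : N a) (q : N b) (r : N (a · b)) →
                  CosetEq S′ (f (a · b) r) (f a p · f b q)
      injective : ∀ a b (p : N a) (q : N b) → CosetEq S′ (f a p) (f b q) → CosetEq S a b
      natural   : ∀ a (p : N a) → f a p ·ₓ x ≡ a ·ₓ x

{-# OPTIONS --safe #-}
module Submission where

-- The map a ↦ a x identifies N_G(S)/S with the set of points whose
-- G-stabiliser is S: a ∈ N_G(S) exactly when Stab_G(a x) = S, and aS = bS
-- exactly when a x = b x.  Such a point y also has Stab_{G′}(y) = S′, and by
-- transitivity y = g x for some g ∈ G′, which then lies in N_{G′}(S′).
-- Sending aS to gS′ is injective since both cosets are read off from y, and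
-- it is multiplicative because a and g agree on every point fixed by S.

open import Defs
open import Data.Nat using (ℕ)
open import Data.Fin using (Fin)
open import Data.Fin.Permutation using (_≈_; inverseˡ; inverseʳ)
open import Data.Product using (_×_; _,_; proj₁; proj₂)
open import Relation.Binary.PropositionalEquality using (_≡_; sym; trans; cong; subst; module ≡-Reasoning)

module _ {n : ℕ} where

  ⁻¹-cancelˡ : ∀ (g : Perm n) y → (g ⁻¹) ·ₓ (g ·ₓ y) ≡ y
  ⁻¹-cancelˡ g y = inverseˡ g

  ⁻¹-cancelʳ : ∀ (g : Perm n) y → g ·ₓ ((g ⁻¹) ·ₓ y) ≡ y
  ⁻¹-cancelʳ g y = inverseʳ g

  ⁻¹-transpose : ∀ (g : Perm n) {y z} → (g ⁻¹) ·ₓ y ≡ z → y ≡ g ·ₓ z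
  ⁻¹-transpose g {y} e = trans (sym (⁻¹-cancelʳ g y)) (cong (g ·ₓ_) e)

  conj-conj⁻¹ : ∀ (g k : Perm n) → (g · (((g ⁻¹) · k) · g)) · (g ⁻¹) ≈ k
  conj-conj⁻¹ g k y = begin
    g ·ₓ ((g ⁻¹) ·ₓ (k ·ₓ (g ·ₓ ((g ⁻¹) ·ₓ y)))) ≡⟨ ⁻¹-cancelʳ g _ ⟩
    k ·ₓ (g ·ₓ ((g ⁻¹) ·ₓ y))                   ≡⟨ cong (k ·ₓ_) (⁻¹-cancelʳ g y) ⟩
    k ·ₓ y                                      ∎
    where open ≡-Reasoning

  _≐_ : PermSet {n} → PermSet → Set
  H ≐ K = H ⊆ K × K ⊆ H

  Stab-restrict : ∀ {H K : PermSet} {y z} → K ⊆ H →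
                  Stab H y ≐ Stab H z → Stab K y ≐ Stab K z
  Stab-restrict K⊆H (y⊆z , z⊆y) =
    (λ k (Kk , ky) → Kk , proj₂ (y⊆z k (K⊆H k Kk , ky))) ,
    (λ k (Kk , kz) → Kk , proj₂ (z⊆y k (K⊆H k Kk , kz)))

module StabiliserProperties {n : ℕ} {H : PermSet {n}} (H-group : IsPermGroup H) where

  open IsPermGroup H-group

  cosetEq⇒·ₓ≡ : ∀ {x a b} → CosetEq (Stab H x) a b → a ·ₓ x ≡ b ·ₓ x
  cosetEq⇒·ₓ≡ {a = a} (_ , e) = sym (⁻¹-transpose a e)

  ·ₓ≡⇒cosetEq : ∀ {x a b} → H a → H b → a ·ₓ x ≡ b ·ₓ x → CosetEq (Stab H x) a b
  ·ₓ≡⇒cosetEq {x} {a} Ha Hb e =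
    ·∈ (⁻¹∈ Ha) Hb , trans (cong ((a ⁻¹) ·ₓ_) (sym e)) (⁻¹-cancelˡ a x)

  conj-Stab : ∀ {g k x} → H g → Stab H x k → Stab H (g ·ₓ x) ((g · k) · (g ⁻¹))
  conj-Stab {g} {k} {x} Hg (Hk , kx) =
    ·∈ (·∈ Hg Hk) (⁻¹∈ Hg) ,
    trans (cong (λ z → g ·ₓ (k ·ₓ z)) (⁻¹-cancelˡ g x)) (cong (g ·ₓ_) kx)

  conj⁻¹-Stab : ∀ {g k x} → H g → Stab H (g ·ₓ x) k → Stab H x (((g ⁻¹) · k) · g)
  conj⁻¹-Stab {g} {x = x} Hg (Hk , kgx) =
    ·∈ (·∈ (⁻¹∈ Hg) Hk) Hg , trans (cong ((g ⁻¹) ·ₓ_) kgx) (⁻¹-cancelˡ g x)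

  Normaliser⇒Stab≐ : ∀ {g x} → Normaliser H (Stab H x) g → Stab H (g ·ₓ x) ≐ Stab H x
  Normaliser⇒Stab≐ {g} {x} (Hg , conj∈ , conj⁻¹∈) =
    (λ k (Hk , kgx) → Hk , trans (sym (conj-conj⁻¹ g k x))
                                 (proj₂ (conj∈ _ (conj⁻¹-Stab Hg (Hk , kgx))))) ,
    (λ k (Hk , kx) → Hk , ⁻¹-transpose g (proj₂ (conj⁻¹∈ k (Hk , kx))))

  Stab≐⇒Normaliser : ∀ {g x} → H g → Stab H (g ·ₓ x) ≐ Stab H x → Normaliser H (Stab H x) g
  Stab≐⇒Normaliser Hg (gx⊆x , x⊆gx) =
    Hg ,
    (λ k xk → gx⊆x _ (conj-Stab Hg xk)) ,
    (λ k xk → conj⁻¹-Stab Hg (x⊆gx k xk))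

  ·ₓ≡-on-fixed : ∀ {a g x y} → H a → H g → a ·ₓ x ≡ g ·ₓ x →
                 Stab H x ⊆ Stab H y → a ·ₓ y ≡ g ·ₓ y
  ·ₓ≡-on-fixed {a} Ha Hg ax≡gx x⊆y =
    sym (⁻¹-transpose a (proj₂ (x⊆y _ (·ₓ≡⇒cosetEq Ha Hg ax≡gx))))

module NaturalEmbeddingConstruction
  {n : ℕ} {G G′ : PermSet {n}} (G-group : IsPermGroup G) (G′-group : IsPermGroup G′)
  (G′⊆G : G′ ⊆ G) (G′-transitive : Transitive G′) (x : Fin n) where

  open StabiliserProperties
  open IsPermGroup

  N = Normaliser G (Stab G x)

  representative : Fin n → Perm n
  representative y = proj₁ (G′-transitive x y)

  representative-∈ : ∀ y → G′ (representative y)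
  representative-∈ y = proj₁ (proj₂ (G′-transitive x y))

  representative-·ₓ : ∀ y → representative y ·ₓ x ≡ y
  representative-·ₓ y = proj₂ (proj₂ (G′-transitive x y))

  f : (a : Perm n) → N a → Perm n
  f a _ = representative (a ·ₓ x)

  f∈ : ∀ a (p : N a) → Normaliser G′ (Stab G′ x) (f a p)
  f∈ a p = Stab≐⇒Normaliser G′-group (representative-∈ (a ·ₓ x))
    (subst (λ y → Stab G′ y ≐ Stab G′ x) (sym (representative-·ₓ (a ·ₓ x)))
      (Stab-restrict G′⊆G (Normaliser⇒Stab≐ G-group p)))

  wellDef : ∀ a b (p : N a) (q : N b) →
            CosetEq (Stab G x) a b → CosetEq (Stab G′ x) (f a p) (f b q)
  wellDef a b _ _ ab =
    ·ₓ≡⇒cosetEq G′-group (representative-∈ (a ·ₓ x)) (representative-∈ (b ·ₓ x))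
      (trans (representative-·ₓ (a ·ₓ x))
        (trans (cosetEq⇒·ₓ≡ G-group {a = a} {b} ab) (sym (representative-·ₓ (b ·ₓ x)))))

  injective : ∀ a b (p : N a) (q : N b) →
              CosetEq (Stab G′ x) (f a p) (f b q) → CosetEq (Stab G x) a b
  injective a b p q fafb =
    ·ₓ≡⇒cosetEq G-group (proj₁ p) (proj₁ q)
      (trans (sym (representative-·ₓ (a ·ₓ x)))
        (trans (cosetEq⇒·ₓ≡ G′-group {a = f a p} {f b q} fafb) (representative-·ₓ (b ·ₓ x))))

  hom : ∀ a b (p : N a) (q : N b) (r : N (a · b)) →
        CosetEq (Stab G′ x) (f (a · b) r) (f a p · f b q)
  hom a b p q r =
    ·ₓ≡⇒cosetEq G′-group (representative-∈ (a ·ₓ (b ·ₓ x)))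
      (·∈ G′-group (representative-∈ (a ·ₓ x)) (representative-∈ (b ·ₓ x)))
      (begin
        f (a · b) r ·ₓ x          ≡⟨ representative-·ₓ (a ·ₓ (b ·ₓ x)) ⟩
        a ·ₓ (b ·ₓ x)             ≡⟨ ·ₓ≡-on-fixed G-group (proj₁ p) (G′⊆G _ (representative-∈ (a ·ₓ x)))
                                       (sym (representative-·ₓ (a ·ₓ x)))
                                       (proj₂ (Normaliser⇒Stab≐ G-group q)) ⟩
        f a p ·ₓ (b ·ₓ x)         ≡⟨ cong (f a p ·ₓ_) (sym (representative-·ₓ (b ·ₓ x))) ⟩
        (f a p · f b q) ·ₓ x      ∎)
    where open ≡-Reasoning

  naturalEmbedding : NaturalEmbedding x N (Stab G x) (Normaliser G′ (Stab G′ x)) (Stab G′ x)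
  naturalEmbedding = record
    { f = f ; f∈ = f∈ ; wellDef = wellDef ; hom = hom ; injective = injective
    ; natural = λ a _ → representative-·ₓ (a ·ₓ x) }

mainTheorem3 : (n : ℕ) (G G′ : PermSet {n}) →
    IsPermGroup G → IsPermGroup G′ → G′ ⊆ G → Transitive G′ →
    (x : Fin n) →
    NaturalEmbedding x
      (Normaliser G (Stab G x)) (Stab G x)
      (Normaliser G′ (Stab G′ x)) (Stab G′ x)
mainTheorem3 n G G′ G-group G′-group G′⊆G G′-transitive x =
  NaturalEmbeddingConstruction.naturalEmbedding G-group G′-group G′⊆G G′-transitive x
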